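{- If there exists a doubly resolvable $(v,3,1)$-BIBD (a $\mathrm{DR}(v,3,1)$-BIBD), then there exists an $\mathrm{R}^*\mathrm{DSTS}(v)$.
   Context: A Steiner triple system $\mathrm{STS}(v)$ ($=(v,3,1)$-BIBD) is a pair $(V,\mathcal{B})$ with $|V|=v$ and $\mathcal{B}$ a family of 3-subsets (blocks) such that every pair of distinct elements lies in exactly one block. A resolution of a block collection on $V$ is a partition of its blocks into classes, each class being a partition of $V$. Two resolutions $\mathcal{R}=\{R_i\}$ and $\mathcal{R}'=\{R'_j\}$ of the same design are orthogonal if $|R_i \cap R'_j| \leq 1$ for all $i,j$. A $\mathrm{DR}(v,3,1)$-BIBD is an $\mathrm{STS}(v)$ admitting a pair of orthogonal resolutions. A $\mathrm{DSTS}(v)$ is the block collection $2\mathcal{B}$ consisting of two (distinct, labeled) copies of each block of an $\mathrm{STS}(v)$ $(V,\mathcal{B})$. A resolution of a $\mathrm{DSTS}(v)$ is self-orthogonal if for any two distinct classes $R_i,R_j$, regarding classes as sets of 3-subsets, $|R_i\cap R_j|\le 1$. An $\mathrm{R}^*\mathrm{DSTS}(v)$ is a $\mathrm{DSTS}(v)$ with a self-orthogonal resolution. -}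

module Defs where

open import Data.Nat using (ℕ)
open import Data.Fin using (Fin)
open import Data.Fin.Subset using (Subset; _∈_; ∣_∣)
open import Data.Product using (Σ; _×_; _,_)
open import Relation.Binary.PropositionalEquality using (_≡_)
open import Relation.Nullary using (¬_)

∃! : {A : Set} → (A → Set) → Set
∃! {A} P = Σ A λ a → P a × (∀ b → P b → b ≡ a)

record STS (v : ℕ) : Set where
  field
    b         : ℕ
    block     : Fin b → Subset v
    triple    : ∀ i → ∣ block i ∣ ≡ 3
    pairUnique : ∀ (x y : Fin v) → ¬ (x ≡ y) →
                 ∃! (λ i → (x ∈ block i) × (y ∈ block i))

IsResolution : {v : ℕ} {I : Set} (B : I → Subset v) (m : ℕ) (r : I → Fin m) → Set
IsResolution {v} {I} B m r =
  ∀ (c : Fin m) (x : Fin v) → ∃! (λ (i : I) → (r i ≡ c) × (x ∈ B i))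

record Resolution {v : ℕ} {I : Set} (B : I → Subset v) : Set where
  field
    m     : ℕ
    cls   : I → Fin m
    isRes : IsResolution B m cls

-- Orthogonality |R_i ∩ R'_j| ≤ 1: no two distinct blocks lie in a common
-- class of both resolutions.
Orthogonal : {v : ℕ} {I : Set} {B : I → Subset v} → Resolution B → Resolution B → Set
Orthogonal {I = I} R R' =
  ∀ (k l : I) → Resolution.cls R k ≡ Resolution.cls R l →
    Resolution.cls R' k ≡ Resolution.cls R' l → k ≡ l

record DR (v : ℕ) : Set where
  field
    sts  : STS v
    res₁ : Resolution (STS.block sts)
    res₂ : Resolution (STS.block sts)
    orth : Orthogonal res₁ res₂

-- DSTS(v): two labeled copies of each block; blocks indexed by Fin 2 × Fin b.
dblock : {v : ℕ} (S : STS v) → Fin 2 × Fin (STS.b S) → Subset v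
dblock S (_ , i) = STS.block S i

-- Self-orthogonal: for distinct classes c ≠ d, the classes (as sets of
-- 3-subsets) share at most one 3-subset.
SelfOrthogonal : {v : ℕ} {I : Set} {B : I → Subset v} → Resolution B → Set
SelfOrthogonal {I = I} {B} R =
  ∀ (k l k' l' : I) →
    cls k ≡ cls l → cls k' ≡ cls l' →
    B k ≡ B k' → B l ≡ B l' → ¬ (B k ≡ B l) →
    cls k ≡ cls k'
  where open Resolution R

record R*DSTS (v : ℕ) : Set where
  field
    sts : STS v
    res : Resolution (dblock sts)
    selfOrth : SelfOrthogonal res

{-# OPTIONS --safe #-}
-- Give the first copy of each block the class it has in the first resolution and the
-- second copy the class it has in the second; the classes of both resolutions together
-- then resolve the doubled design. Two distinct classes can only share two triples if one
-- class comes from each resolution, and then those two blocks would lie in a common class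
-- of both resolutions, which orthogonality forbids.
module Submission where

open import Defs
open import Data.Nat using (ℕ; _+_; _<_)
open import Data.Nat.Properties using (n≤1+n; ≤-pred)
open import Data.Bool using (true; false)
open import Data.Fin using (Fin; zero; suc)
open import Data.Fin.Properties using (suc-injective; +↔⊎)
open import Data.Fin.Subset using (Subset; _∈_; ∣_∣; Nonempty)
open import Data.Vec using (_∷_; here; there)
open import Data.Sum using (_⊎_; inj₁; inj₂)
open import Data.Sum.Properties using (inj₁-injective; inj₂-injective)
open import Data.Product using (_×_; _,_; proj₂; ∃₂)
open import Data.Empty using (⊥-elim)
open import Function using (_∘_; _↔_; Inverse; Injection)
open import Function.Properties.Inverse using (↔-sym; Inverse⇒Injection)
open import Function.Definitions using (Injective)
open import Relation.Binary.PropositionalEquality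
  using (_≡_; _≢_; refl; sym; trans; cong; subst)

0<∣p∣⇒Nonempty : ∀ {n} (p : Subset n) → 0 < ∣ p ∣ → Nonempty p
0<∣p∣⇒Nonempty (true ∷ p) _ = zero , here
0<∣p∣⇒Nonempty (false ∷ p) 0<∣p∣ with 0<∣p∣⇒Nonempty p 0<∣p∣
... | x , x∈p = suc x , there x∈p

1<∣p∣⇒distinct-members : ∀ {n} (p : Subset n) → 1 < ∣ p ∣ →
                         ∃₂ λ x y → x ≢ y × x ∈ p × y ∈ p
1<∣p∣⇒distinct-members (true ∷ p) 1<∣p∣ with 0<∣p∣⇒Nonempty p (≤-pred 1<∣p∣)
... | y , y∈p = zero , suc y , (λ ()) , here , there y∈p
1<∣p∣⇒distinct-members (false ∷ p) 1<∣p∣ with 1<∣p∣⇒distinct-members p 1<∣p∣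
... | x , y , x≢y , x∈p , y∈p =
  suc x , suc y , x≢y ∘ suc-injective , there x∈p , there y∈p

module _ {v : ℕ} (S : STS v) where
  open STS S

  block-injective : Injective _≡_ _≡_ block
  block-injective {i} {j} Bi≡Bj
    with 1<∣p∣⇒distinct-members (block i) (subst (1 <_) (sym (triple i)) (n≤1+n 2))
  ... | x , y , x≢y , x∈Bi , y∈Bi with pairUnique x y x≢y
  ... | _ , _ , unique =
    trans (unique i (x∈Bi , y∈Bi))
          (sym (unique j (subst (x ∈_) Bi≡Bj x∈Bi , subst (y ∈_) Bi≡Bj y∈Bi)))

-- IsResolution and SelfOrthogonal with classes in an arbitrary type, so that the classes
-- can be formed in Fin m₁ ⊎ Fin m₂ and only then renumbered into Fin (m₁ + m₂).
module _ {v : ℕ} {I : Set} (B : I → Subset v) where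

  ResolvesBy : {C : Set} → (I → C) → Set
  ResolvesBy r = ∀ c x → ∃! λ i → r i ≡ c × x ∈ B i

  SelfOrthogonalBy : {C : Set} → (I → C) → Set
  SelfOrthogonalBy r = ∀ k l k' l' → r k ≡ r l → r k' ≡ r l' →
                       B k ≡ B k' → B l ≡ B l' → B k ≢ B l → r k ≡ r k'

  module _ {C D : Set} (e : D ↔ C) where
    open Inverse e

    private
      from-injective : Injective _≡_ _≡_ from
      from-injective = Injection.injective (Inverse⇒Injection (↔-sym e))

    relabel-resolves : {r : I → C} → ResolvesBy r → ResolvesBy (from ∘ r)
    relabel-resolves {r} resolves d x with resolves (to d) x
    ... | i , (ri≡to-d , x∈Bi) , unique =
      i , (trans (cong from ri≡to-d) (strictlyInverseʳ d) , x∈Bi) ,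
      λ j (from-rj≡d , x∈Bj) →
        unique j (trans (sym (strictlyInverseˡ (r j))) (cong to from-rj≡d) , x∈Bj)

    relabel-selfOrthogonal : {r : I → C} → SelfOrthogonalBy r → SelfOrthogonalBy (from ∘ r)
    relabel-selfOrthogonal selfOrth k l k' l' e₁ e₂ Bk≡Bk' Bl≡Bl' Bk≢Bl =
      cong from (selfOrth k l k' l' (from-injective e₁) (from-injective e₂) Bk≡Bk' Bl≡Bl' Bk≢Bl)

module _ {v : ℕ} {I : Set} {B : I → Subset v} (R₁ R₂ : Resolution B) where
  private
    module R₁ = Resolution R₁
    module R₂ = Resolution R₂

  copyClass : Fin 2 × I → Fin R₁.m ⊎ Fin R₂.m
  copyClass (zero , i)     = inj₁ (R₁.cls i)
  copyClass (suc zero , i) = inj₂ (R₂.cls i)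

  copyClass-resolves : ResolvesBy (B ∘ proj₂) copyClass
  copyClass-resolves (inj₁ c) x with R₁.isRes c x
  ... | i , (ci≡c , x∈Bi) , unique = (zero , i) , (cong inj₁ ci≡c , x∈Bi) , unique₀
    where
    unique₀ : ∀ k → copyClass k ≡ inj₁ c × x ∈ B (proj₂ k) → k ≡ (zero , i)
    unique₀ (zero , j)     (cj≡c , x∈Bj) =
      cong (zero ,_) (unique j (inj₁-injective cj≡c , x∈Bj))
    unique₀ (suc zero , j) (() , _)
  copyClass-resolves (inj₂ c) x with R₂.isRes c x
  ... | i , (ci≡c , x∈Bi) , unique = (suc zero , i) , (cong inj₂ ci≡c , x∈Bi) , unique₁
    where
    unique₁ : ∀ k → copyClass k ≡ inj₂ c × x ∈ B (proj₂ k) → k ≡ (suc zero , i)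
    unique₁ (zero , j)     (() , _)
    unique₁ (suc zero , j) (cj≡c , x∈Bj) =
      cong (suc zero ,_) (unique j (inj₂-injective cj≡c , x∈Bj))

  sameClass₁ : ∀ {a i j} → copyClass (zero , i) ≡ copyClass (a , j) → R₁.cls i ≡ R₁.cls j
  sameClass₁ {zero} ci≡cj = inj₁-injective ci≡cj
  sameClass₁ {suc zero} ()

  sameClass₂ : ∀ {a i j} → copyClass (suc zero , i) ≡ copyClass (a , j) → R₂.cls i ≡ R₂.cls j
  sameClass₂ {zero} ()
  sameClass₂ {suc zero} ci≡cj = inj₂-injective ci≡cj

  orthogonal⇒copy-determined : Orthogonal R₁ R₂ → ∀ {a a' b b' i j} → i ≢ j →
    copyClass (a , i) ≡ copyClass (a' , j) → copyClass (b , i) ≡ copyClass (b' , j) → a ≡ b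
  orthogonal⇒copy-determined orth {zero}     {b = zero}     _   _  _  = refl
  orthogonal⇒copy-determined orth {suc zero} {b = suc zero} _   _  _  = refl
  orthogonal⇒copy-determined orth {zero}     {b = suc zero} i≢j e₁ e₂ =
    ⊥-elim (i≢j (orth _ _ (sameClass₁ e₁) (sameClass₂ e₂)))
  orthogonal⇒copy-determined orth {suc zero} {b = zero}     i≢j e₁ e₂ =
    ⊥-elim (i≢j (orth _ _ (sameClass₁ e₂) (sameClass₂ e₁)))

  copyClass-selfOrthogonal : Injective _≡_ _≡_ B → Orthogonal R₁ R₂ →
                             SelfOrthogonalBy (B ∘ proj₂) copyClass
  copyClass-selfOrthogonal B-injective orth (a , i) (_ , j) (b , i') (_ , j')
                           e₁ e₂ Bi≡Bi' Bj≡Bj' Bi≢Bj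
    with B-injective Bi≡Bi' | B-injective Bj≡Bj'
  ... | refl | refl =
    cong (λ c → copyClass (c , i)) (orthogonal⇒copy-determined orth (Bi≢Bj ∘ cong B) e₁ e₂)

  _⊎ᴿ_ : Resolution (B ∘ proj₂)
  _⊎ᴿ_ = record
    { m     = R₁.m + R₂.m
    ; cls   = Inverse.from +↔⊎ ∘ copyClass
    ; isRes = relabel-resolves (B ∘ proj₂) +↔⊎ copyClass-resolves
    }

  ⊎ᴿ-selfOrthogonal : Injective _≡_ _≡_ B → Orthogonal R₁ R₂ → SelfOrthogonal _⊎ᴿ_
  ⊎ᴿ-selfOrthogonal B-injective orth =
    relabel-selfOrthogonal (B ∘ proj₂) +↔⊎ (copyClass-selfOrthogonal B-injective orth)

lemma1p3 : (v : ℕ) → DR v → R*DSTS v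
lemma1p3 v D = record
  { sts      = sts
  ; res      = res₁ ⊎ᴿ res₂
  ; selfOrth = ⊎ᴿ-selfOrthogonal res₁ res₂ (block-injective sts) orth
  }
  where open DR D
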